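{- Let $n,\ell,a$ be integers with $1<\ell<n-1$ and $\ell+a\not\equiv 0\pmod 4$. Then there is no balancedly splittable Hadamard matrix with parameters $(n,\ell,a,-a)$.
   Context: A Hadamard matrix of order $n$ is an $n\times n$ $\{1,-1\}$-matrix $H$ with $HH^\top=nI_n$; $J_n$ is the all-ones matrix. $H$ is balancedly splittable with parameters $(n,\ell,a,b)$ if, after permuting its rows, $H=\begin{pmatrix}H_1\\H_2\end{pmatrix}$ with $H_1$ an $\ell\times n$ matrix such that $H_1^\top H_1=\ell I_n+aA+b(J_n-A-I_n)$ for integers $a\ge b$ and a symmetric $(0,1)$-matrix $A$ with zero diagonal. -}

module Defs where

open import Data.Nat using (ℕ; zero; suc)
open import Data.Fin using (Fin; zero; suc)
open import Data.Integer using (ℤ; +_; _+_; _-_; _*_; -_; _≤_)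
open import Data.Product using (Σ; _×_; ∃)
open import Data.Sum using (_⊎_)
open import Function.Bundles using (_↣_; Injection)
open import Relation.Binary.PropositionalEquality using (_≡_)
open import Relation.Nullary using (Dec; yes; no)
open import Data.Fin using (_≟_)

Matrix : ℕ → ℕ → Set
Matrix m n = Fin m → Fin n → ℤ

∑ : (n : ℕ) → (Fin n → ℤ) → ℤ
∑ zero    f = + 0
∑ (suc n) f = f zero + ∑ n (λ i → f (suc i))

δ : {n : ℕ} → Fin n → Fin n → ℤ
δ i j with i ≟ j
... | yes _ = + 1
... | no  _ = + 0

_·ᵀ : {m n : ℕ} → Matrix m n → Matrix m m
_·ᵀ {m} {n} M i k = ∑ n (λ j → M i j * M k j)

ᵀ·_ : {m n : ℕ} → Matrix m n → Matrix n n
ᵀ·_ {m} {n} M j k = ∑ m (λ i → M i j * M i k)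

PlusMinusOne : {m n : ℕ} → Matrix m n → Set
PlusMinusOne M = ∀ i j → (M i j ≡ + 1) ⊎ (M i j ≡ - + 1)

IsHadamard : (n : ℕ) → Matrix n n → Set
IsHadamard n H = PlusMinusOne H × (∀ i k → (H ·ᵀ) i k ≡ + n * δ i k)

IsAdjacency : (n : ℕ) → Matrix n n → Set
IsAdjacency n A =
  (∀ i j → (A i j ≡ + 0) ⊎ (A i j ≡ + 1)) ×
  (∀ i j → A i j ≡ A j i) ×
  (∀ i → A i i ≡ + 0)

-- H is balancedly splittable with parameters (n, ℓ, a, b):
-- after permuting rows, the first ℓ rows form H₁ (equivalently, H₁ consists of
-- ℓ distinct rows of H, chosen by an injection σ : Fin ℓ ↣ Fin n), and
-- H₁ᵀ H₁ = ℓ I + a A + b (J - A - I) for a symmetric (0,1)-matrix A with zero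
-- diagonal, where a ≥ b.
BalancedlySplittable : (n ℓ : ℕ) (a b : ℤ) → Matrix n n → Set
BalancedlySplittable n ℓ a b H =
  b ≤ a ×
  Σ (Fin ℓ ↣ Fin n) λ σ →
  Σ (Matrix n n) λ A →
    IsAdjacency n A ×
    (∀ j k → (ᵀ· (λ i c → H (Injection.to σ i) c)) j k
             ≡ + ℓ * δ j k + a * A j k + b * (+ 1 - A j k - δ j k))

module Submission where

-- Let H₁ consist of the ℓ selected rows of the Hadamard matrix H and
-- let G = H₁ᵀH₁, so G has diagonal ℓ and off-diagonal entries ±a.
--   (1) The rows of H₁ are orthogonal of norm n, hence G² = nG.
--   (2) H₁ is a {1,-1}-matrix, so every "triangle sum" G_jk + G_jm + G_mk + ℓ
--       is divisible by 4 (each row contributes x_j x_k + x_j x_m + x_m x_k + 1 ∈ {0,4}).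
--   (3) Since 4 ∤ ℓ + a, (2) forbids an odd number of entries -a in a triangle;
--       consequently a ≠ 0 and G_jm G_mk = a G_jk for distinct j, k, m.
--   (4) Reading (1) at the position (0,1), with g = G₀₁ = ±a ≠ 0, and using (3) for
--       the n - 2 ≥ 1 remaining indices gives (2ℓ + (n-2)a) g = n g, so 2ℓ + (n-2)a = n.
--   (5) For 2 ≤ ℓ ≤ n-2 and a ≠ 0 this integer equation has no solution.

open import Defs
open import Data.Nat using (ℕ; _<_; _∸_)
open import Data.Integer using (ℤ; +_; _+_; -_)
open import Data.Integer.Divisibility using (_∣_)
open import Data.Product using (Σ; _×_)
open import Relation.Nullary using (¬_)

import Data.Nat as ℕ
import Data.Nat.Properties as ℕP
open import Data.Integer using (_*_; _-_; 0ℤ; +[1+_]; -[1+_]; ≢-nonZero)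
import Data.Integer.Properties as ℤP
import Data.Integer.Divisibility.Signed as Signed
open import Data.Integer.Tactic.RingSolver using (solve-∀)
open import Data.Fin using (Fin; zero; suc)
import Data.Fin as Fin
import Data.Fin.Properties as FinP
open import Data.Product using (_,_)
open import Data.Sum using (_⊎_; inj₁; inj₂)
open import Data.Empty using (⊥; ⊥-elim)
open import Function using (_∘_)
open import Function.Bundles using (_↣_; Injection)
open import Function.Definitions using (Injective)
open import Relation.Binary.PropositionalEquality
open import Relation.Nullary using (yes; no)

open Signed using (divides) renaming (_∣_ to _∣ₛ_)

∑-cong : ∀ n {f g : Fin n → ℤ} → (∀ i → f i ≡ g i) → ∑ n f ≡ ∑ n g
∑-cong ℕ.zero    eq = refl
∑-cong (ℕ.suc n) eq = cong₂ _+_ (eq zero) (∑-cong n (eq ∘ suc))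

∑-zero : ∀ n → ∑ n (λ _ → 0ℤ) ≡ 0ℤ
∑-zero ℕ.zero    = refl
∑-zero (ℕ.suc n) = trans (ℤP.+-identityˡ _) (∑-zero n)

∑-const : ∀ n c → ∑ n (λ _ → c) ≡ + n * c
∑-const ℕ.zero    c = refl
∑-const (ℕ.suc n) c = trans (cong (_+_ c) (∑-const n c)) (one-more c (+ n))
  where
  -- + suc n is definitionally + 1 + + n
  one-more : ∀ c x → c + x * c ≡ (+ 1 + x) * c
  one-more = solve-∀

∑-+ : ∀ n (f g : Fin n → ℤ) → ∑ n (λ i → f i + g i) ≡ ∑ n f + ∑ n g
∑-+ ℕ.zero    f g = refl
∑-+ (ℕ.suc n) f g =
  trans (cong (_+_ (f zero + g zero)) (∑-+ n (f ∘ suc) (g ∘ suc)))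
        (interchange (f zero) (g zero) (∑ n (f ∘ suc)) (∑ n (g ∘ suc)))
  where
  interchange : ∀ a b c d → (a + b) + (c + d) ≡ (a + c) + (b + d)
  interchange = solve-∀

∑-*ˡ : ∀ n c (f : Fin n → ℤ) → ∑ n (λ i → c * f i) ≡ c * ∑ n f
∑-*ˡ ℕ.zero    c f = sym (ℤP.*-zeroʳ c)
∑-*ˡ (ℕ.suc n) c f =
  trans (cong (_+_ (c * f zero)) (∑-*ˡ n c (f ∘ suc)))
        (sym (ℤP.*-distribˡ-+ c (f zero) (∑ n (f ∘ suc))))

∑-*ʳ : ∀ n c (f : Fin n → ℤ) → ∑ n (λ i → f i * c) ≡ ∑ n f * c
∑-*ʳ n c f = begin
  ∑ n (λ i → f i * c)  ≡⟨ ∑-cong n (λ i → ℤP.*-comm (f i) c) ⟩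
  ∑ n (λ i → c * f i)  ≡⟨ ∑-*ˡ n c f ⟩
  c * ∑ n f            ≡⟨ ℤP.*-comm c (∑ n f) ⟩
  ∑ n f * c            ∎
  where open ≡-Reasoning

∑-swap : ∀ m n (f : Fin m → Fin n → ℤ) →
  ∑ m (λ i → ∑ n (f i)) ≡ ∑ n (λ j → ∑ m (λ i → f i j))
∑-swap ℕ.zero    n f = sym (∑-zero n)
∑-swap (ℕ.suc m) n f =
  trans (cong (_+_ (∑ n (f zero))) (∑-swap m n (f ∘ suc)))
        (sym (∑-+ n (f zero) (λ j → ∑ m (λ i → f (suc i) j))))

∑-single : ∀ n (f : Fin n → ℤ) i → (∀ j → j ≢ i → f j ≡ 0ℤ) → ∑ n f ≡ f i
∑-single (ℕ.suc n) f zero vanish =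
  trans (cong (_+_ (f zero)) (trans (∑-cong n (λ j → vanish (suc j) λ ())) (∑-zero n)))
        (ℤP.+-identityʳ (f zero))
∑-single (ℕ.suc n) f (suc i) vanish =
  trans (cong₂ _+_ (vanish zero λ ())
                   (∑-single n (f ∘ suc) i (λ j j≢i → vanish (suc j) (j≢i ∘ FinP.suc-injective))))
        (ℤP.+-identityˡ (f (suc i)))

∑-divisible : ∀ {d} n (f : Fin n → ℤ) → (∀ i → d ∣ₛ f i) → d ∣ₛ ∑ n f
∑-divisible ℕ.zero    f d∣f = divides 0ℤ refl
∑-divisible (ℕ.suc n) f d∣f = Signed.∣m∣n⇒∣m+n (d∣f zero) (∑-divisible n (f ∘ suc) (d∣f ∘ suc))

δ-refl : ∀ {n} (i : Fin n) → δ i i ≡ + 1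
δ-refl i with i Fin.≟ i
... | yes _   = refl
... | no  i≢i = ⊥-elim (i≢i refl)

δ-distinct : ∀ {n} (i j : Fin n) → i ≢ j → δ i j ≡ 0ℤ
δ-distinct i j i≢j with i Fin.≟ j
... | yes i≡j = ⊥-elim (i≢j i≡j)
... | no  _   = refl

δ-injective : ∀ {m n} {f : Fin m → Fin n} → Injective _≡_ _≡_ f → ∀ i j → δ (f i) (f j) ≡ δ i j
δ-injective {f = f} f-inj i j with i Fin.≟ j
... | yes refl = δ-refl (f i)
... | no  i≢j  = δ-distinct (f i) (f j) (i≢j ∘ f-inj)

∑-δ : ∀ n (f : Fin n → ℤ) i → ∑ n (λ j → f j * δ i j) ≡ f i
∑-δ n f i = begin
  ∑ n (λ j → f j * δ i j) ≡⟨ ∑-single n _ i (λ j j≢i →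
                               trans (cong (f j *_) (δ-distinct i j (j≢i ∘ sym))) (ℤP.*-zeroʳ (f j))) ⟩
  f i * δ i i             ≡⟨ cong (f i *_) (δ-refl i) ⟩
  f i * + 1               ≡⟨ ℤP.*-identityʳ (f i) ⟩
  f i                     ∎
  where open ≡-Reasoning

selectRows : ∀ {ℓ r c} → (Fin ℓ ↣ Fin r) → Matrix r c → Matrix ℓ c
selectRows σ X i = X (Injection.to σ i)

OrthogonalRows : ∀ {r c} → ℤ → Matrix r c → Set
OrthogonalRows s X = ∀ i k → (X ·ᵀ) i k ≡ s * δ i k

selectRows-orthogonal : ∀ {ℓ r c s} (σ : Fin ℓ ↣ Fin r) (X : Matrix r c) →
  OrthogonalRows s X → OrthogonalRows s (selectRows σ X)
selectRows-orthogonal {s = s} σ X orth i k =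
  trans (orth _ _) (cong (s *_) (δ-injective (Injection.injective σ) i k))

-- If X Xᵀ = s I then G = XᵀX satisfies G² = s G, since G² = Xᵀ(XXᵀ)X.
gram-square : ∀ {r c s} (X : Matrix r c) → OrthogonalRows s X →
  ∀ j k → ∑ c (λ m → (ᵀ· X) j m * (ᵀ· X) m k) ≡ s * (ᵀ· X) j k
gram-square {r} {c} {s} X orth j k = begin
  ∑ c (λ m → G j m * G m k)
    ≡⟨ ∑-cong c expand ⟩
  ∑ c (λ m → ∑ r (λ i → ∑ r (λ i' → (X i j * X i' k) * (X i m * X i' m))))
    ≡⟨ ∑-swap c r _ ⟩
  ∑ r (λ i → ∑ c (λ m → ∑ r (λ i' → (X i j * X i' k) * (X i m * X i' m))))
    ≡⟨ ∑-cong r (λ i → ∑-swap c r _) ⟩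
  ∑ r (λ i → ∑ r (λ i' → ∑ c (λ m → (X i j * X i' k) * (X i m * X i' m))))
    ≡⟨ ∑-cong r (λ i → ∑-cong r (λ i' →
         trans (∑-*ˡ c (X i j * X i' k) _) (cong ((X i j * X i' k) *_) (orth i i')))) ⟩
  ∑ r (λ i → ∑ r (λ i' → (X i j * X i' k) * (s * δ i i')))
    ≡⟨ ∑-cong r (λ i → trans (∑-cong r (λ i' → reassoc (X i j) (X i' k) s (δ i i')))
                              (∑-δ r (λ i' → s * (X i j * X i' k)) i)) ⟩
  ∑ r (λ i → s * (X i j * X i k))
    ≡⟨ ∑-*ˡ r s _ ⟩
  s * G j k ∎
  where
  open ≡-Reasoning
  G : Matrix c c
  G = ᵀ· X
  reassoc : ∀ x y s d → (x * y) * (s * d) ≡ (s * (x * y)) * d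
  reassoc = solve-∀
  regroup : ∀ a b c d → (a * b) * (c * d) ≡ (a * d) * (b * c)
  regroup = solve-∀
  expand : ∀ m → G j m * G m k ≡
           ∑ r (λ i → ∑ r (λ i' → (X i j * X i' k) * (X i m * X i' m)))
  expand m = trans (sym (∑-*ʳ r (G m k) (λ i → X i j * X i m)))
    (∑-cong r (λ i → trans (sym (∑-*ˡ r (X i j * X i m) (λ i' → X i' m * X i' k)))
                           (∑-cong r (λ i' → regroup (X i j) (X i m) (X i' m) (X i' k)))))

infix 4 _≡±_
_≡±_ : ℤ → ℤ → Set
g ≡± a = (g ≡ a) ⊎ (g ≡ - a)

sign-triangle : ∀ {x y z} → x ≡± + 1 → y ≡± + 1 → z ≡± + 1 → + 4 ∣ₛ x * y + x * z + z * y + + 1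
sign-triangle (inj₁ refl) (inj₁ refl) (inj₁ refl) = divides (+ 1) refl
sign-triangle (inj₁ refl) (inj₁ refl) (inj₂ refl) = divides 0ℤ refl
sign-triangle (inj₁ refl) (inj₂ refl) (inj₁ refl) = divides 0ℤ refl
sign-triangle (inj₁ refl) (inj₂ refl) (inj₂ refl) = divides 0ℤ refl
sign-triangle (inj₂ refl) (inj₁ refl) (inj₁ refl) = divides 0ℤ refl
sign-triangle (inj₂ refl) (inj₁ refl) (inj₂ refl) = divides 0ℤ refl
sign-triangle (inj₂ refl) (inj₂ refl) (inj₁ refl) = divides 0ℤ refl
sign-triangle (inj₂ refl) (inj₂ refl) (inj₂ refl) = divides (+ 1) refl

-- For a {1,-1}-matrix X with ℓ rows and G = XᵀX, 4 divides G_jk + G_jm + G_mk + ℓ: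
-- the sum is the sum over rows of the quantities in sign-triangle.
gram-triangle : ∀ {ℓ c} (X : Matrix ℓ c) → PlusMinusOne X →
  ∀ j k m → + 4 ∣ₛ (ᵀ· X) j k + (ᵀ· X) j m + (ᵀ· X) m k + + ℓ
gram-triangle {ℓ} X ±1 j k m = subst (+ 4 ∣ₛ_) sum-split
  (∑-divisible ℓ _ (λ i → sign-triangle (±1 i j) (±1 i k) (±1 i m)))
  where
  sum-split : ∑ ℓ (λ i → X i j * X i k + X i j * X i m + X i m * X i k + + 1)
              ≡ (ᵀ· X) j k + (ᵀ· X) j m + (ᵀ· X) m k + + ℓ
  sum-split = trans (∑-+ ℓ _ _)
    (cong₂ _+_ (trans (∑-+ ℓ _ _) (cong (_+ _) (∑-+ ℓ _ _)))
               (trans (∑-const ℓ (+ 1)) (ℤP.*-identityʳ (+ ℓ))))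

shifted-by-four : ∀ {X} ℓ a c → X ≡ (ℓ + a) + c * + 4 → + 4 ∣ₛ X → + 4 ∣ₛ ℓ + a
shifted-by-four ℓ a c refl 4∣X = Signed.∣m+n∣n⇒∣m 4∣X (divides c refl)

-- With 4 ∤ ℓ + a, a triangle of entries ±a whose sum is ≡ -ℓ (mod 4) contains an
-- even number of entries -a; equivalently g₀ₘ gₘ₁ = a g₀₁.
sign-rule : ∀ ℓ a {g₀₁ g₀ₘ gₘ₁} → ¬ (+ 4 ∣ₛ ℓ + a) →
  g₀₁ ≡± a → g₀ₘ ≡± a → gₘ₁ ≡± a → + 4 ∣ₛ g₀₁ + g₀ₘ + gₘ₁ + ℓ → g₀ₘ * gₘ₁ ≡ a * g₀₁
sign-rule ℓ a 4∤ (inj₁ refl) (inj₁ refl) (inj₁ refl) _ = refl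
sign-rule ℓ a 4∤ (inj₁ refl) (inj₁ refl) (inj₂ refl) d = ⊥-elim (4∤ (shifted-by-four ℓ a 0ℤ (one-minus ℓ a) d))
  where one-minus : ∀ ℓ a → a + a + - a + ℓ ≡ (ℓ + a) + 0ℤ * + 4
        one-minus = solve-∀
sign-rule ℓ a 4∤ (inj₁ refl) (inj₂ refl) (inj₁ refl) d = ⊥-elim (4∤ (shifted-by-four ℓ a 0ℤ (one-minus ℓ a) d))
  where one-minus : ∀ ℓ a → a + - a + a + ℓ ≡ (ℓ + a) + 0ℤ * + 4
        one-minus = solve-∀
sign-rule ℓ a 4∤ (inj₁ refl) (inj₂ refl) (inj₂ refl) _ = neg-square a
  where neg-square : ∀ a → - a * - a ≡ a * a
        neg-square = solve-∀
sign-rule ℓ a 4∤ (inj₂ refl) (inj₁ refl) (inj₁ refl) d = ⊥-elim (4∤ (shifted-by-four ℓ a 0ℤ (one-minus ℓ a) d))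
  where one-minus : ∀ ℓ a → - a + a + a + ℓ ≡ (ℓ + a) + 0ℤ * + 4
        one-minus = solve-∀
sign-rule ℓ a 4∤ (inj₂ refl) (inj₁ refl) (inj₂ refl) _ = refl
sign-rule ℓ a 4∤ (inj₂ refl) (inj₂ refl) (inj₁ refl) _ = ℤP.*-comm (- a) a
sign-rule ℓ a 4∤ (inj₂ refl) (inj₂ refl) (inj₂ refl) d = ⊥-elim (4∤ (shifted-by-four ℓ a (- a) (three-minus ℓ a) d))
  where three-minus : ∀ ℓ a → - a + - a + - a + ℓ ≡ (ℓ + a) + - a * + 4
        three-minus = solve-∀

±zero : ∀ {g} → g ≡± 0ℤ → g ≡ 0ℤ
±zero (inj₁ g≡0) = g≡0
±zero (inj₂ g≡0) = g≡0

-- Under the hypotheses of the sign rule a ≠ 0, since for a = 0 the triangle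
-- condition would read 4 ∣ ℓ.
nonzero-entries : ∀ ℓ a {g₀₁ g₀ₘ gₘ₁} → ¬ (+ 4 ∣ₛ ℓ + a) →
  g₀₁ ≡± a → g₀ₘ ≡± a → gₘ₁ ≡± a → + 4 ∣ₛ g₀₁ + g₀ₘ + gₘ₁ + ℓ → a ≢ 0ℤ
nonzero-entries ℓ .0ℤ 4∤ g₀₁ g₀ₘ gₘ₁ d refl
  rewrite ±zero g₀₁ | ±zero g₀ₘ | ±zero gₘ₁ = 4∤ (shifted-by-four ℓ 0ℤ 0ℤ (all-zero ℓ) d)
  where
  all-zero : ∀ ℓ → 0ℤ + 0ℤ + 0ℤ + ℓ ≡ (ℓ + 0ℤ) + 0ℤ * + 4
  all-zero = solve-∀

-- For 2 ≤ ℓ ≤ m and a ≠ 0 the equation 2ℓ + m a = m + 2 has no solution: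
-- for a > 0 the left side is at least 4 + m, for a < 0 it forces 2ℓ ≥ 2m + 2.
eigenvalue-equation-unsolvable : ∀ ℓ m a → 1 < ℓ → ℓ < ℕ.suc m → a ≢ 0ℤ →
  + 2 * + ℓ + + m * a ≢ + (2 ℕ.+ m)
eigenvalue-equation-unsolvable ℓ m (+ 0) _ _ a≢0 _ = a≢0 refl
eigenvalue-equation-unsolvable ℓ m +[1+ p ] 1<ℓ _ _ eq = ℕP.<-irrefl refl (begin-strict
  2 ℕ.+ m                     <⟨ ℕP.+-monoˡ-< m (ℕ.s≤s (ℕ.s≤s (ℕ.s≤s ℕ.z≤n))) ⟩
  4 ℕ.+ m                     ≤⟨ ℕP.+-mono-≤ (ℕP.*-monoʳ-≤ 2 1<ℓ) (ℕP.m≤m*n m (ℕ.suc p)) ⟩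
  2 ℕ.* ℓ ℕ.+ m ℕ.* ℕ.suc p   ≡⟨ ℤP.+-injective (trans (ℤP.pos-+ (2 ℕ.* ℓ) _)
                                  (trans (cong₂ _+_ (ℤP.pos-* 2 ℓ) (ℤP.pos-* m (ℕ.suc p))) eq)) ⟩
  2 ℕ.+ m                     ∎)
  where open ℕP.≤-Reasoning
eigenvalue-equation-unsolvable ℓ m -[1+ q ] _ ℓ<1+m _ eq = ℕP.<-irrefl refl 2ℓ<2ℓ
  where
  move : ∀ x y z → x ≡ (x + y * - z) + y * z
  move = solve-∀
  eq-in-ℕ : 2 ℕ.* ℓ ≡ 2 ℕ.+ m ℕ.+ m ℕ.* ℕ.suc q
  eq-in-ℕ = ℤP.+-injective (begin
    + (2 ℕ.* ℓ)                                     ≡⟨ trans (ℤP.pos-* 2 ℓ) (move _ (+ m) (+ ℕ.suc q)) ⟩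
    (+ 2 * + ℓ + + m * -[1+ q ]) + + m * + ℕ.suc q  ≡⟨ cong₂ _+_ eq (sym (ℤP.pos-* m (ℕ.suc q))) ⟩
    + (2 ℕ.+ m) + + (m ℕ.* ℕ.suc q)                 ≡⟨ ℤP.pos-+ (2 ℕ.+ m) _ ⟨
    + (2 ℕ.+ m ℕ.+ m ℕ.* ℕ.suc q)                   ∎)
    where open ≡-Reasoning
  2ℓ<2ℓ : 2 ℕ.* ℓ ℕ.< 2 ℕ.* ℓ
  2ℓ<2ℓ = begin-strict
    2 ℕ.* ℓ                         ≤⟨ ℕP.*-monoʳ-≤ 2 (ℕP.≤-pred ℓ<1+m) ⟩
    m ℕ.+ (m ℕ.+ 0)                 ≡⟨ cong (ℕ._+_ m) (ℕP.+-identityʳ m) ⟩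
    m ℕ.+ m                         <⟨ ℕP.+-monoˡ-< m (ℕP.m<n+m m {2} (ℕ.s≤s ℕ.z≤n)) ⟩
    2 ℕ.+ m ℕ.+ m                   ≤⟨ ℕP.+-monoʳ-≤ (2 ℕ.+ m) (ℕP.m≤m*n m (ℕ.suc q)) ⟩
    2 ℕ.+ m ℕ.+ m ℕ.* ℕ.suc q       ≡⟨ eq-in-ℕ ⟨
    2 ℕ.* ℓ                         ∎
    where open ℕP.≤-Reasoning

splitting-diagonal : ∀ ℓ a {A d} → A ≡ 0ℤ → d ≡ + 1 →
  ℓ * d + a * A + - a * (+ 1 - A - d) ≡ ℓ
splitting-diagonal ℓ a refl refl = evaluate ℓ a
  where evaluate : ∀ ℓ a → ℓ * + 1 + a * 0ℤ + - a * (+ 1 - 0ℤ - + 1) ≡ ℓ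
        evaluate = solve-∀

splitting-off-diagonal : ∀ ℓ a {A d} → (A ≡ 0ℤ) ⊎ (A ≡ + 1) → d ≡ 0ℤ →
  ℓ * d + a * A + - a * (+ 1 - A - d) ≡± a
splitting-off-diagonal ℓ a (inj₁ refl) refl = inj₂ (evaluate ℓ a)
  where evaluate : ∀ ℓ a → ℓ * 0ℤ + a * 0ℤ + - a * (+ 1 - 0ℤ - 0ℤ) ≡ - a
        evaluate = solve-∀
splitting-off-diagonal ℓ a (inj₂ refl) refl = inj₁ (evaluate ℓ a)
  where evaluate : ∀ ℓ a → ℓ * 0ℤ + a * + 1 + - a * (+ 1 - + 1 - 0ℤ) ≡ a
        evaluate = solve-∀

±-nonzero : ∀ {g a} → g ≡± a → a ≢ 0ℤ → g ≢ 0ℤ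
±-nonzero (inj₁ refl) a≢0 = a≢0
±-nonzero (inj₂ refl) a≢0 = a≢0 ∘ ℤP.neg-injective

-- At position (0,1), with g = G₀₁, each of the t + 1 indices m ≥ 2 contributes
-- G₀ₘGₘ₁ = a g by the sign rule, so (2ℓ + (1 + t)a) g = (3 + t) g with g ≠ 0.
no-two-valued-gram : ∀ t ℓ a (G : Matrix (3 ℕ.+ t) (3 ℕ.+ t)) →
  1 < ℓ → ℓ < 2 ℕ.+ t → ¬ (+ 4 ∣ₛ + ℓ + a) →
  (∀ j → G j j ≡ + ℓ) →
  (∀ j k → j ≢ k → G j k ≡± a) →
  (∀ j k m → + 4 ∣ₛ G j k + G j m + G m k + + ℓ) →
  (∀ j k → ∑ (3 ℕ.+ t) (λ m → G j m * G m k) ≡ + (3 ℕ.+ t) * G j k) → ⊥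
no-two-valued-gram t ℓ a G 1<ℓ ℓ<2+t 4∤ diagonal off-diagonal triangle square =
  eigenvalue-equation-unsolvable ℓ (ℕ.suc t) a 1<ℓ ℓ<2+t a≢0
    (ℤP.*-cancelʳ-≡ _ _ g {{≢-nonZero (±-nonzero g≡±a a≢0)}} eigen-equation)
  where
  open ≡-Reasoning
  0' 1' : Fin (3 ℕ.+ t)
  0' = zero
  1' = suc zero
  other : Fin (ℕ.suc t) → Fin (3 ℕ.+ t)
  other m = suc (suc m)
  g : ℤ
  g = G 0' 1'
  g≡±a : g ≡± a
  g≡±a = off-diagonal 0' 1' λ ()
  a≢0 : a ≢ 0ℤ
  a≢0 = nonzero-entries (+ ℓ) a 4∤ g≡±a (off-diagonal _ _ λ ()) (off-diagonal _ _ λ ())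
          (triangle 0' 1' (other zero))
  through-other : ∀ m → G 0' (other m) * G (other m) 1' ≡ a * g
  through-other m = sign-rule (+ ℓ) a 4∤ g≡±a (off-diagonal _ _ λ ()) (off-diagonal _ _ λ ())
                      (triangle 0' 1' (other m))
  collect : ∀ ℓ s a g → (+ 2 * ℓ + s * a) * g ≡ ℓ * g + (g * ℓ + s * (a * g))
  collect = solve-∀
  eigen-equation : (+ 2 * + ℓ + + ℕ.suc t * a) * g ≡ + (3 ℕ.+ t) * g
  eigen-equation = begin
    (+ 2 * + ℓ + + ℕ.suc t * a) * g
      ≡⟨ collect (+ ℓ) (+ ℕ.suc t) a g ⟩
    + ℓ * g + (g * + ℓ + + ℕ.suc t * (a * g))
      ≡⟨ cong₂ (λ x y → x * g + (g * y + + ℕ.suc t * (a * g))) (diagonal 0') (diagonal 1') ⟨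
    G 0' 0' * g + (g * G 1' 1' + + ℕ.suc t * (a * g))
      ≡⟨ cong (λ s → G 0' 0' * g + (g * G 1' 1' + s))
              (trans (∑-cong (ℕ.suc t) through-other) (∑-const (ℕ.suc t) (a * g))) ⟨
    ∑ (3 ℕ.+ t) (λ m → G 0' m * G m 1')
      ≡⟨ square 0' 1' ⟩
    + (3 ℕ.+ t) * g ∎

-- For n ≤ 2 the hypotheses 1 < ℓ < n - 1 are contradictory.  Otherwise G = H₁ᵀH₁
-- satisfies the hypotheses of no-two-valued-gram: its entries come from the splitting
-- equation, the triangle condition from H₁ being a {1,-1}-matrix, and G² = nG from the
-- orthogonality of the rows of H.
proposition2p16 : (n ℓ : ℕ) (a : ℤ) → 1 < ℓ → ℓ < n ∸ 1 →
    ¬ ((+ 4) ∣ (+ ℓ + a)) →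
    ¬ (Σ (Matrix n n) λ H → IsHadamard n H × BalancedlySplittable n ℓ a (- a) H)
proposition2p16 0 ℓ a _ () _
proposition2p16 1 ℓ a _ () _
proposition2p16 2 ℓ a 1<ℓ ℓ<1 _ _ = ℕP.<-asym 1<ℓ ℓ<1
proposition2p16 (ℕ.suc (ℕ.suc (ℕ.suc t))) ℓ a 1<ℓ ℓ<2+t 4∤
  (H , (±1 , orthogonal) , (_ , σ , A , (A∈01 , _ , A-diagonal) , split)) =
  no-two-valued-gram t ℓ a (ᵀ· H₁) 1<ℓ ℓ<2+t (4∤ ∘ Signed.∣⇒∣ᵤ)
    (λ j → trans (split j j) (splitting-diagonal (+ ℓ) a (A-diagonal j) (δ-refl j)))
    (λ j k j≢k → subst (_≡± a) (sym (split j k))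
                   (splitting-off-diagonal (+ ℓ) a (A∈01 j k) (δ-distinct j k j≢k)))
    (gram-triangle H₁ (±1 ∘ Injection.to σ))
    (gram-square {s = + (3 ℕ.+ t)} H₁ (selectRows-orthogonal {s = + (3 ℕ.+ t)} σ H orthogonal))
  where
  H₁ : Matrix ℓ (3 ℕ.+ t)
  H₁ = selectRows σ H
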